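{- Let $(V,E,d)$ be a Bratteli diagram such that all the maps $\varphi_n$ are one-to-one, and suppose $K_0(V,E,d)$ has finite rank. Then $\operatorname{rank}(V,E,d)=\operatorname{rank}(K_0(V,E,d))$, and there exists $N\geq1$ such that $|V_n|=\operatorname{rank}(K_0(V,E,d))$ for all $n>N$.
   Context: A Bratteli diagram $(V,E,d)$ has levels $V=\bigsqcup_{n\geq0}V_n$, $E=\bigsqcup_{n\geq1}E_n$ of nonempty finite sets, range/source maps $r,s$ with $r[E_n]\subseteq V_n$, $s[E_n]\subseteq V_{n-1}$, $s^{ -1}(v)\neq\emptyset$, and labels $d:V\to\mathbb{N}\setminus\{0\}$ with $d(v)\geq\sum_{r(e)=v}d(s(e))$ for $v\notin V_0$. The incidence matrix $M_n$ (rows $V_n$, columns $V_{n-1}$) counts edges from $v\in V_{n-1}$ to $u\in V_n$, and $\varphi_n:\mathbb{Z}^{V_{n-1}}\to\mathbb{Z}^{V_n}$ is multiplication by $M_n$. $K_0(V,E,d)$ is the direct limit of the groups $\mathbb{Z}^{V_n}$ along the $\varphi_n$ (with the induced order); its rank is the maximal size of a $\mathbb{Z}$-linearly independent subset. $\operatorname{rank}(V,E,d)=\liminf_{n\to\infty}|V_n|$. -}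

module Defs where

open import Data.Nat using (ℕ; zero; suc; _+_; _*_; _≤_; _<_; _≤′_; ≤′-reflexive; ≤′-step)
open import Data.Integer as ℤ using (ℤ; +_)
open import Data.Fin using (Fin; zero; suc; _≟_)
open import Data.Bool using (_∧_; if_then_else_)
open import Data.Product using (Σ; ∃; _×_; _,_; proj₁; proj₂)
open import Relation.Nullary.Decidable using (does)
open import Relation.Binary.PropositionalEquality using (_≡_; subst)

sumℕ : ∀ r → (Fin r → ℕ) → ℕ
sumℕ zero    f = 0
sumℕ (suc r) f = f zero + sumℕ r (λ i → f (suc i))

sumℤ : ∀ r → (Fin r → ℤ) → ℤ
sumℤ zero    f = + 0
sumℤ (suc r) f = f zero ℤ.+ sumℤ r (λ i → f (suc i))

-- A Bratteli diagram (V,E,d).  V_n = Fin (nV n) (n ≥ 0);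
-- the paper's E_{n+1} = Fin (nE n), with r : E_{n+1} → V_{n+1}, s : E_{n+1} → V_n.
record BratteliDiagram : Set where
  field
    nV     : ℕ → ℕ
    nV-pos : ∀ n → 1 ≤ nV n
    nE     : ℕ → ℕ
    nE-pos : ∀ n → 1 ≤ nE n
    r      : ∀ n → Fin (nE n) → Fin (nV (suc n))
    s      : ∀ n → Fin (nE n) → Fin (nV n)
    s-out  : ∀ n (v : Fin (nV n)) → ∃ λ e → s n e ≡ v
    d      : ∀ n → Fin (nV n) → ℕ
    d-pos  : ∀ n v → 1 ≤ d n v
    d-ineq : ∀ n (u : Fin (nV (suc n))) →
             sumℕ (nE n) (λ e → if does (r n e ≟ u) then d n (s n e) else 0) ≤ d (suc n) u

module _ (D : BratteliDiagram) where
  open BratteliDiagram D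

  -- incidence matrix: number of edges from v ∈ V_n to u ∈ V_{n+1}
  -- (this is the paper's M_{n+1})
  incidence : ∀ n → Fin (nV (suc n)) → Fin (nV n) → ℕ
  incidence n u v =
    sumℕ (nE n) (λ e → if does (r n e ≟ u) ∧ does (s n e ≟ v) then 1 else 0)

  Zlevel : ℕ → Set
  Zlevel n = Fin (nV n) → ℤ

  -- φ : ℤ^{V_n} → ℤ^{V_{n+1}}, multiplication by the incidence matrix
  -- (this is the paper's φ_{n+1})
  φ : ∀ n → Zlevel n → Zlevel (suc n)
  φ n x u = sumℤ (nV n) (λ v → + incidence n u v ℤ.* x v)

  lift : ∀ {n p} → n ≤′ p → Zlevel n → Zlevel p
  lift (≤′-reflexive eq) x = subst Zlevel eq x
  lift (≤′-step h)       x = φ _ (lift h x)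

  φ-Injective : ℕ → Set
  φ-Injective n = ∀ (x y : Zlevel n) → (∀ u → φ n x u ≡ φ n y u) → ∀ v → x v ≡ y v

  -- representatives of elements of the direct limit K₀(V,E,d)
  K0Rep : Set
  K0Rep = Σ ℕ Zlevel

  -- Σ_i c_i [a_i] = 0 in the direct limit K₀(V,E,d)
  CombZero : ∀ {k} → (Fin k → ℤ) → (Fin k → K0Rep) → Set
  CombZero {k} c a =
    ∃ λ p → Σ (∀ i → proj₁ (a i) ≤′ p) λ h →
      ∀ u → sumℤ k (λ i → c i ℤ.* lift (h i) (proj₂ (a i)) u) ≡ + 0

  LinIndep : ∀ {k} → (Fin k → K0Rep) → Set
  LinIndep {k} a = ∀ (c : Fin k → ℤ) → CombZero c a → ∀ i → c i ≡ + 0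

  K0HasRank : ℕ → Set
  K0HasRank R = (Σ (Fin R → K0Rep) LinIndep)
              × (∀ k (a : Fin k → K0Rep) → LinIndep a → k ≤ R)

IsLiminf : (ℕ → ℕ) → ℕ → Set
IsLiminf f R = (∃ λ N → ∀ n → N ≤ n → R ≤ f n) × (∀ N → ∃ λ n → N ≤ n × f n ≡ R)

-- Since every φ is injective, so is every connecting map ℤ^{V_n} → ℤ^{V_p}; hence the standard
-- basis of ℤ^{V_n} stays independent in K₀ and |V_n| ≤ rank K₀ for all n. Conversely, R independent
-- elements of K₀ are represented at a common level N and stay independent in ℤ^{V_n} for n ≥ N,
-- and independent vectors in ℤ^m number at most m (Gaussian elimination), so R ≤ |V_n| for n ≥ N.
module Submission where

open import Defs
open import Data.Nat using (ℕ; _≤_; _<_)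
open import Data.Product using (∃; _×_)
open import Relation.Binary.PropositionalEquality using (_≡_)

open import Data.Nat using (zero; suc; z≤n; s≤s; _⊔_; _≤′_; ≤′-reflexive; ≤′-step)
open import Data.Nat.Properties using (≡-irrelevant; <-irrefl; ≤-reflexive; ≤-trans; ≤-antisym; ≤⇒≤′; ≤′⇒≤; m≤m⊔n; m≤n⊔m; m≤n⇒m≤1+n; n≤1+n; <⇒≤)
open import Data.Integer using (ℤ; +_; _+_; _*_; -_; _-_; 0ℤ; 1ℤ) renaming (_≟_ to _≟ℤ_)
open import Data.Integer.Properties using (*-zeroʳ; *-identityʳ; +-identityʳ; i*j≡0⇒i≡0∨j≡0)
open import Data.Integer.Tactic.RingSolver using (solve-∀)
open import Data.Fin using (Fin; zero; suc; punchIn; _≟_)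
open import Data.Fin.Properties using (punchInᵢ≢i; any?)
open import Data.Vec.Functional using (insertAt; removeAt)
open import Data.Vec.Functional.Properties using (insertAt-lookup; insertAt-punchIn)
open import Data.Product using (_,_; proj₁; proj₂)
open import Data.Sum using (inj₁; inj₂)
open import Data.Empty using (⊥-elim)
open import Relation.Nullary using (yes; no; ¬_; ¬?)
open import Relation.Binary.PropositionalEquality using (refl; sym; trans; cong; cong₂; module ≡-Reasoning)

sum-cong : ∀ k {f g : Fin k → ℤ} → (∀ i → f i ≡ g i) → sumℤ k f ≡ sumℤ k g
sum-cong zero    f≗g = refl
sum-cong (suc k) f≗g = cong₂ _+_ (f≗g zero) (sum-cong k (λ i → f≗g (suc i)))

sum-zero : ∀ k {f : Fin k → ℤ} → (∀ i → f i ≡ 0ℤ) → sumℤ k f ≡ 0ℤ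
sum-zero zero    f≗0 = refl
sum-zero (suc k) f≗0 = cong₂ _+_ (f≗0 zero) (sum-zero k (λ i → f≗0 (suc i)))

sum-+ : ∀ k (f g : Fin k → ℤ) → sumℤ k (λ i → f i + g i) ≡ sumℤ k f + sumℤ k g
sum-+ zero    f g = refl
sum-+ (suc k) f g = trans (cong (_+_ (f zero + g zero)) (sum-+ k (λ i → f (suc i)) (λ i → g (suc i))))
                          (interchange (f zero) (g zero) _ _)
  where
  interchange : ∀ a b x y → a + b + (x + y) ≡ a + x + (b + y)
  interchange = solve-∀

sum-distribˡ : ∀ k (a : ℤ) (f : Fin k → ℤ) → sumℤ k (λ i → a * f i) ≡ a * sumℤ k f
sum-distribˡ zero    a f = sym (*-zeroʳ a)
sum-distribˡ (suc k) a f = trans (cong (_+_ (a * f zero)) (sum-distribˡ k a (λ i → f (suc i))))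
                                 (distrib a (f zero) _)
  where
  distrib : ∀ a b x → a * b + a * x ≡ a * (b + x)
  distrib = solve-∀

sum-comm : ∀ k m (f : Fin k → Fin m → ℤ) →
           sumℤ k (λ i → sumℤ m (f i)) ≡ sumℤ m (λ v → sumℤ k (λ i → f i v))
sum-comm zero    m f = sym (sum-zero m (λ _ → refl))
sum-comm (suc k) m f = begin
  sumℤ m (f zero) + sumℤ k (λ i → sumℤ m (f (suc i)))
    ≡⟨ cong (_+_ (sumℤ m (f zero))) (sum-comm k m (λ i → f (suc i))) ⟩
  sumℤ m (f zero) + sumℤ m (λ v → sumℤ k (λ i → f (suc i) v))
    ≡⟨ sym (sum-+ m (f zero) _) ⟩
  sumℤ m (λ v → sumℤ (suc k) (λ i → f i v)) ∎
  where open ≡-Reasoning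

sum-removeAt : ∀ k (f : Fin (suc k) → ℤ) j → sumℤ (suc k) f ≡ f j + sumℤ k (removeAt f j)
sum-removeAt k       f zero    = refl
sum-removeAt (suc k) f (suc j) =
  trans (cong (_+_ (f zero)) (sum-removeAt k (λ i → f (suc i)) j)) (swap (f zero) (f (suc j)) _)
  where
  swap : ∀ a b x → a + (b + x) ≡ b + (a + x)
  swap = solve-∀

combination : ∀ {k m} → (Fin k → ℤ) → (Fin k → Fin m → ℤ) → Fin m → ℤ
combination {k} c w u = sumℤ k (λ i → c i * w i u)

apply : ∀ {l m} → (Fin l → Fin m → ℤ) → (Fin m → ℤ) → Fin l → ℤ
apply {m = m} M x u = sumℤ m (λ v → M u v * x v)

Independent : ∀ {k m} → (Fin k → Fin m → ℤ) → Set
Independent w = ∀ c → (∀ u → combination c w u ≡ 0ℤ) → ∀ i → c i ≡ 0ℤ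

combination-apply : ∀ {k l m} (M : Fin l → Fin m → ℤ) (c : Fin k → ℤ) (x : Fin k → Fin m → ℤ) u →
                    combination c (λ i → apply M (x i)) u ≡ apply M (combination c x) u
combination-apply {k} {m = m} M c x u = begin
  sumℤ k (λ i → c i * sumℤ m (λ v → M u v * x i v))
    ≡⟨ sym (sum-cong k (λ i → sum-distribˡ m (c i) _)) ⟩
  sumℤ k (λ i → sumℤ m (λ v → c i * (M u v * x i v)))
    ≡⟨ sum-comm k m _ ⟩
  sumℤ m (λ v → sumℤ k (λ i → c i * (M u v * x i v)))
    ≡⟨ sum-cong m (λ v → trans (sum-cong k (λ i → exchange (c i) (M u v) (x i v)))
                               (sum-distribˡ k (M u v) _)) ⟩
  sumℤ m (λ v → M u v * sumℤ k (λ i → c i * x i v)) ∎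
  where
  open ≡-Reasoning
  exchange : ∀ a b x → a * (b * x) ≡ b * (a * x)
  exchange = solve-∀

combination-insertAt : ∀ {k m} (c : Fin k → ℤ) j x (w : Fin (suc k) → Fin m → ℤ) u →
                       combination (insertAt c j x) w u ≡ x * w j u + combination c (removeAt w j) u
combination-insertAt {k} c j x w u =
  trans (sum-removeAt k (λ i → insertAt c j x i * w i u) j)
        (cong₂ _+_ (cong (_* w j u) (insertAt-lookup c j x))
                   (sum-cong k (λ i → cong (_* w (punchIn j i) u) (insertAt-punchIn c j x i))))

eliminate : ∀ {k m} → (Fin (suc k) → Fin (suc m) → ℤ) → Fin (suc k) → Fin k → Fin m → ℤ
eliminate w j i u = w j zero * w (punchIn j i) (suc u) - w (punchIn j i) zero * w j (suc u)

combination-eliminate : ∀ {k m} (w : Fin (suc k) → Fin (suc m) → ℤ) j (c : Fin k → ℤ) u →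
  combination c (eliminate w j) u
    ≡ w j zero * combination c (removeAt w j) (suc u) - combination c (removeAt w j) zero * w j (suc u)
combination-eliminate {k} w j c u = begin
  sumℤ k (λ i → c i * eliminate w j i u)
    ≡⟨ sum-cong k (λ i → expand (c i) (w j zero) (w (punchIn j i) (suc u)) (w (punchIn j i) zero) (w j (suc u))) ⟩
  sumℤ k (λ i → a * (c i * w (punchIn j i) (suc u)) + b * (c i * w (punchIn j i) zero))
    ≡⟨ sum-+ k _ _ ⟩
  sumℤ k (λ i → a * (c i * w (punchIn j i) (suc u))) + sumℤ k (λ i → b * (c i * w (punchIn j i) zero))
    ≡⟨ cong₂ _+_ (sum-distribˡ k a _) (sum-distribˡ k b _) ⟩
  a * combination c (removeAt w j) (suc u) + b * combination c (removeAt w j) zero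
    ≡⟨ collect a (combination c (removeAt w j) (suc u)) (w j (suc u)) _ ⟩
  a * combination c (removeAt w j) (suc u) - combination c (removeAt w j) zero * w j (suc u) ∎
  where
  open ≡-Reasoning
  a = w j zero
  b = - w j (suc u)
  expand : ∀ c a p q r → c * (a * p - q * r) ≡ a * (c * p) + (- r) * (c * q)
  expand = solve-∀
  collect : ∀ a x r y → a * x + (- r) * y ≡ a * x - y * r
  collect = solve-∀

-- The pivot coefficient cancels coordinate zero; on the other coordinates the combination is
-- that of c against the eliminated rows.
lifted-relation : ∀ {k m} (w : Fin (suc k) → Fin (suc m) → ℤ) j → (Fin k → ℤ) → Fin (suc k) → ℤ
lifted-relation w j c = insertAt (λ i → c i * w j zero) j (- combination c (removeAt w j) zero)

lifted-relation-vanishes : ∀ {k m} (w : Fin (suc k) → Fin (suc m) → ℤ) j (c : Fin k → ℤ) →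
                           (∀ u → combination c (eliminate w j) u ≡ 0ℤ) →
                           ∀ u → combination (lifted-relation w j c) w u ≡ 0ℤ
lifted-relation-vanishes {k} w j c c-rel = vanishes
  where
  a = w j zero
  S = combination c (removeAt w j) zero
  expand : ∀ u → combination (lifted-relation w j c) w u ≡ - S * w j u + a * combination c (removeAt w j) u
  expand u = trans (combination-insertAt (λ i → c i * a) j (- S) w u)
    (cong (_+_ (- S * w j u)) (trans (sum-cong k (λ i → rearrange (c i) a (w (punchIn j i) u)))
                                     (sum-distribˡ k a _)))
    where
    rearrange : ∀ c a x → c * a * x ≡ a * (c * x)
    rearrange = solve-∀
  vanishes : ∀ u → combination (lifted-relation w j c) w u ≡ 0ℤ
  vanishes zero    = trans (expand zero) (cancel S a)
    where
    cancel : ∀ s a → - s * a + a * s ≡ 0ℤ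
    cancel = solve-∀
  vanishes (suc u) = begin
    combination (lifted-relation w j c) w (suc u)
      ≡⟨ trans (expand (suc u)) (reorder S (w j (suc u)) _ a) ⟩
    a * combination c (removeAt w j) (suc u) - S * w j (suc u)
      ≡⟨ sym (combination-eliminate w j c u) ⟩
    combination c (eliminate w j) u
      ≡⟨ c-rel u ⟩
    0ℤ ∎
    where
    open ≡-Reasoning
    reorder : ∀ s b x a → - s * b + a * x ≡ a * x - s * b
    reorder = solve-∀

eliminate-independent : ∀ {k m} (w : Fin (suc k) → Fin (suc m) → ℤ) j → ¬ w j zero ≡ 0ℤ →
                        Independent w → Independent (eliminate w j)
eliminate-independent w j pivot≢0 w-indep c c-rel i
  with i*j≡0⇒i≡0∨j≡0 (c i) (trans (sym (insertAt-punchIn _ j _ i))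
                                   (w-indep (lifted-relation w j c) (lifted-relation-vanishes w j c c-rel) (punchIn j i)))
... | inj₁ cᵢ≡0 = cᵢ≡0
... | inj₂ a≡0  = ⊥-elim (pivot≢0 a≡0)

drop-zero-column-independent : ∀ {k m} (w : Fin k → Fin (suc m) → ℤ) → (∀ i → w i zero ≡ 0ℤ) →
                               Independent w → Independent (λ i u → w i (suc u))
drop-zero-column-independent {k} w column≡0 w-indep c c-rel = w-indep c λ
  { zero    → sum-zero k (λ i → trans (cong (c i *_) (column≡0 i)) (*-zeroʳ (c i)))
  ; (suc u) → c-rel u }

independent⇒≤ : ∀ {k} m (w : Fin k → Fin m → ℤ) → Independent w → k ≤ m
independent⇒≤ {zero}  m       w w-indep = z≤n
independent⇒≤ {suc k} zero    w w-indep with w-indep (λ _ → 1ℤ) (λ ()) zero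
... | ()
independent⇒≤ {suc k} (suc m) w w-indep with any? (λ j → ¬? (w j zero ≟ℤ 0ℤ))
... | yes (j , pivot≢0) = s≤s (independent⇒≤ m (eliminate w j) (eliminate-independent w j pivot≢0 w-indep))
... | no no-pivot       = m≤n⇒m≤1+n (independent⇒≤ m (λ i u → w i (suc u)) (drop-zero-column-independent w column≡0 w-indep))
  where
  column≡0 : ∀ j → w j zero ≡ 0ℤ
  column≡0 j with w j zero ≟ℤ 0ℤ
  ... | yes w≡0 = w≡0
  ... | no  w≢0 = ⊥-elim (no-pivot (j , w≢0))

basis : ∀ {m} → Fin m → Fin m → ℤ
basis v w with v ≟ w
... | yes _ = 1ℤ
... | no  _ = 0ℤ

combination-basis : ∀ {m} (c : Fin m → ℤ) w → combination c basis w ≡ c w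
combination-basis {suc m} c w = begin
  combination c basis w
    ≡⟨ sum-removeAt m (λ v → c v * basis v w) w ⟩
  c w * basis w w + sumℤ m (λ i → c (punchIn w i) * basis (punchIn w i) w)
    ≡⟨ cong₂ _+_ (trans (cong (c w *_) basis-diagonal) (*-identityʳ (c w)))
                 (sum-zero m (λ i → trans (cong (c (punchIn w i) *_) (basis-off i)) (*-zeroʳ (c (punchIn w i))))) ⟩
  c w + 0ℤ
    ≡⟨ +-identityʳ (c w) ⟩
  c w ∎
  where
  open ≡-Reasoning
  basis-diagonal : basis w w ≡ 1ℤ
  basis-diagonal with w ≟ w
  ... | yes _   = refl
  ... | no  w≢w = ⊥-elim (w≢w refl)
  basis-off : ∀ i → basis (punchIn w i) w ≡ 0ℤ
  basis-off i with punchIn w i ≟ w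
  ... | yes eq = ⊥-elim (punchInᵢ≢i w i eq)
  ... | no  _  = refl

≤′-irrelevant : ∀ {m n} (p q : m ≤′ n) → p ≡ q
≤′-irrelevant (≤′-reflexive e)    (≤′-reflexive e′)  = cong ≤′-reflexive (≡-irrelevant e e′)
≤′-irrelevant (≤′-reflexive refl) (≤′-step q)        = ⊥-elim (<-irrefl refl (≤′⇒≤ q))
≤′-irrelevant (≤′-step p)         (≤′-reflexive refl) = ⊥-elim (<-irrefl refl (≤′⇒≤ p))
≤′-irrelevant (≤′-step p)         (≤′-step q)        = cong ≤′-step (≤′-irrelevant p q)

upper-bound : ∀ k (f : Fin k → ℕ) → ∃ λ N → ∀ i → f i ≤ N
upper-bound zero    f = 0 , λ ()
upper-bound (suc k) f with upper-bound k (λ i → f (suc i))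
... | N , bound = f zero ⊔ N , λ { zero → m≤m⊔n (f zero) N ; (suc i) → ≤-trans (bound i) (m≤n⊔m (f zero) N) }

eventually-constant⇒liminf : ∀ (f : ℕ → ℕ) R → (∃ λ N → ∀ n → N ≤ n → f n ≡ R) → IsLiminf f R
eventually-constant⇒liminf f R (N , f≡R) =
  (N , λ n N≤n → ≤-reflexive (sym (f≡R n N≤n))) ,
  λ M → M ⊔ N , m≤m⊔n M N , f≡R (M ⊔ N) (m≤n⊔m M N)

module _ (D : BratteliDiagram) where
  open BratteliDiagram D

  lift-combination : ∀ {n p} (h : n ≤′ p) {k} (c : Fin k → ℤ) (x : Fin k → Zlevel D n) u →
                     combination c (λ i → lift D h (x i)) u ≡ lift D h (combination c x) u
  lift-combination (≤′-reflexive refl) c x u = refl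
  lift-combination (≤′-step {q} h)     c x u =
    trans (combination-apply (λ u v → + incidence D q u v) c (λ i → lift D h (x i)) u)
          (sum-cong (nV q) (λ v → cong (+ incidence D q u v *_) (lift-combination h c x v)))

  module _ (injective : ∀ n → φ-Injective D n) where

    lift-kernel : ∀ {n p} (h : n ≤′ p) (x : Zlevel D n) → (∀ u → lift D h x u ≡ 0ℤ) → ∀ v → x v ≡ 0ℤ
    lift-kernel (≤′-reflexive refl) x x↦0 = x↦0
    lift-kernel (≤′-step {q} h)     x x↦0 = lift-kernel h x (injective q (lift D h x) (λ _ → 0ℤ) φx≡φ0)
      where
      φx≡φ0 : ∀ u → φ D q (lift D h x) u ≡ φ D q (λ _ → 0ℤ) u
      φx≡φ0 u = trans (x↦0 u) (sym (sum-zero (nV q) (λ v → *-zeroʳ (+ incidence D q u v))))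

    basis-linIndep : ∀ n → LinIndep D (λ v → n , basis v)
    basis-linIndep n c (p , n≤p , c-rel) w = begin
      c w                            ≡⟨ sym (combination-basis c w) ⟩
      combination c basis w          ≡⟨ lift-kernel n≤′p (combination c basis) lifted-rel w ⟩
      0ℤ                             ∎
      where
      open ≡-Reasoning
      n≤′p = n≤p w
      lifted-rel : ∀ u → lift D n≤′p (combination c basis) u ≡ 0ℤ
      lifted-rel u = trans (sym (lift-combination n≤′p c basis u))
        (trans (sum-cong (nV n) (λ v → cong (λ h → c v * lift D h (basis v) u) (≤′-irrelevant n≤′p (n≤p v))))
               (c-rel u))

    nV≤rank : ∀ R → K0HasRank D R → ∀ n → nV n ≤ R
    nV≤rank R (_ , maximal) n = maximal (nV n) (λ v → n , basis v) (basis-linIndep n)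

  rank≤nV-eventually : ∀ R → K0HasRank D R → ∃ λ N → ∀ n → N ≤ n → R ≤ nV n
  rank≤nV-eventually R ((a , a-indep) , _) with upper-bound R (λ i → proj₁ (a i))
  ... | N , levels≤N = N , λ n N≤n →
    let a≤′n = λ i → ≤⇒≤′ (≤-trans (levels≤N i) N≤n)
    in independent⇒≤ (nV n) (λ i → lift D (a≤′n i) (proj₂ (a i))) (λ c c-rel → a-indep c (n , a≤′n , c-rel))

mainTheorem12 : (D : BratteliDiagram) → (∀ n → φ-Injective D n) → (R : ℕ) → K0HasRank D R →
    IsLiminf (BratteliDiagram.nV D) R × (∃ λ N → 1 ≤ N × (∀ n → N < n → BratteliDiagram.nV D n ≡ R))
mainTheorem12 D injective R rank =
  eventually-constant⇒liminf (nV D) R (N , nV≡R) ,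
  (suc N , s≤s z≤n , λ n N<n → nV≡R n (≤-trans (n≤1+n N) (<⇒≤ N<n)))
  where
  open BratteliDiagram using (nV)
  N = proj₁ (rank≤nV-eventually D R rank)
  nV≡R : ∀ n → N ≤ n → nV D n ≡ R
  nV≡R n N≤n = ≤-antisym (nV≤rank D injective R rank n) (proj₂ (rank≤nV-eventually D R rank) n N≤n)
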